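{- A full sequence $(p_\lambda(\mathbf y))_{\lambda}$ of symmetric functions is of binomial type if and only if there is a quasi-genus $(G_\lambda)_\lambda$ such that, for every partition $\lambda$, $p_\lambda(\mathbf y)$ enumerates the $\mathbf G$-generic functions from a set with a partition of type $\lambda$, i.e. $$p_\lambda(\mathbf y)=\sum_{f:S\to\{1,2,\dots\}}\Big(\prod_{k\ge1}G_{\mathrm{type}(\pi|_{f^{ -1}(k)})}\Big)\prod_{s\in S}y_{f(s)},$$ where $S$ is a finite set with a partition $\pi$ of type $\lambda$.
   Context: Partitions $\lambda$ are nonincreasing eventually-zero sequences of nonnegative integers. For a set partition $\pi$ of $S$ and $T\subseteq S$, $\pi|_T=\{B\cap T: B\in\pi, B\cap T\ne\emptyset\}$, and the type of a set partition is the integer partition of its block sizes (the empty partition has type $(0)$). A quasi-genus is a family of complex numbers $(G_\lambda)$ indexed by partitions with $G_{(0)}=1$ and $G_{(1)}\ne0$ (e.g. the numbers of structures of a genus). Order the partitions of $n$ in reverse lexicographic order ($\lambda>\mu$ iff the first nonzero $\lambda_i-\mu_i$ is positive); the exact degree of a nonzero homogeneous symmetric function $p=\sum c_\mu m_\mu$ of degree $n$ is the largest $\lambda\vdash n$ with $c_\lambda\ne0$, where $m_\mu$ are monomial symmetric functions in $\mathbf y=(y_1,y_2,\dots)$. A full sequence is a family $(p_\lambda)$ of homogeneous symmetric functions indexed by all partitions with $p_\lambda$ of exact degree $\lambda$. For a vector $\alpha$ of nonnegative integers with finite support, $p_\alpha$ denotes $p_\mu$ with $\mu$ the decreasing rearrangement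 of $\alpha$ (similarly $G_\alpha$). The full sequence is of binomial type if for disjoint variable sets $\mathbf y,\mathbf z$: $p_\lambda(\mathbf y\cup\mathbf z)=\sum_{\alpha}\binom\lambda\alpha p_\alpha(\mathbf y)p_{\lambda-\alpha}(\mathbf z)$, the sum over vectors $0\le\alpha\le\lambda$ componentwise, with $\binom\lambda\alpha=\lambda!/(\alpha!(\lambda-\alpha)!)$ and $\alpha!=\prod_i\alpha_i!$. -}

module Defs where

open import Level using (_⊔_)
open import Algebra.Bundles using (CommutativeRing)
open import Data.Bool using (Bool; true; false; if_then_else_; _∧_)
open import Data.Nat using (ℕ; zero; suc; _∸_; _≤_; _<_; _≤ᵇ_; _≡ᵇ_)
open import Data.Nat.Combinatorics using (_C_)
open import Data.List using (List; []; _∷_; _++_; map; concatMap; upTo; replicate; zipWith; length; foldr)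
open import Data.Nat.ListAction using (sum; product)
open import Data.Product using (_×_; ∃; _,_)
open import Data.Unit using (⊤)
open import Data.Empty using (⊥)
open import Data.Sum using (_⊎_)
open import Relation.Nullary using (¬_)
open import Relation.Binary.PropositionalEquality using (_≡_)

IsPartition : List ℕ → Set
IsPartition []           = ⊤
IsPartition (x ∷ [])     = 0 < x
IsPartition (x ∷ y ∷ ys) = y ≤ x × IsPartition (y ∷ ys)

insertDesc : ℕ → List ℕ → List ℕ
insertDesc x []       = x ∷ []
insertDesc x (y ∷ ys) = if y ≤ᵇ x then x ∷ y ∷ ys else y ∷ insertDesc x ys

dropZeros : List ℕ → List ℕ
dropZeros []           = []
dropZeros (zero ∷ xs)  = dropZeros xs
dropZeros (suc x ∷ xs) = suc x ∷ dropZeros xs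

norm : List ℕ → List ℕ
norm xs = foldr insertDesc [] (dropZeros xs)

RevLexGT : List ℕ → List ℕ → Set
RevLexGT []       []       = ⊥
RevLexGT []       (y ∷ ys) = 0 ≡ y × RevLexGT [] ys
RevLexGT (x ∷ xs) []       = 0 < x ⊎ (x ≡ 0 × RevLexGT xs [])
RevLexGT (x ∷ xs) (y ∷ ys) = y < x ⊎ (x ≡ y × RevLexGT xs ys)

boxes : List ℕ → List (List ℕ)
boxes []       = [] ∷ []
boxes (x ∷ xs) = concatMap (λ i → map (i ∷_) (boxes xs)) (upTo (suc x))

_-ᴸ_ : List ℕ → List ℕ → List ℕ
λ' -ᴸ α = zipWith _∸_ λ' α

binomL : List ℕ → List ℕ → ℕ
binomL λ' α = product (zipWith _C_ λ' α)

-- The canonical set S = {0,…,|λ|-1} with the partition π of type λ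
-- whose j-th block is a run of λ_j consecutive elements; an element is
-- recorded by its block label.

labelsFrom : ℕ → List ℕ → List ℕ
labelsFrom j []       = []
labelsFrom j (x ∷ xs) = replicate x j ++ labelsFrom (suc j) xs

labels : List ℕ → List ℕ
labels = labelsFrom 0

allFuns : ℕ → ℕ → List (List ℕ)
allFuns zero    k = [] ∷ []
allFuns (suc n) k = concatMap (λ v → map (v ∷_) (allFuns n k)) (upTo k)

countTrue : List Bool → ℕ
countTrue []           = 0
countTrue (true ∷ bs)  = suc (countTrue bs)
countTrue (false ∷ bs) = countTrue bs

fiberSizes : ℕ → List ℕ → List ℕ
fiberSizes k f = map (λ i → countTrue (map (λ v → v ≡ᵇ i) f)) (upTo k)

-- type(π|_{f⁻¹(i)}) : sizes of the nonempty intersections of blocks with f⁻¹(i)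
restrictType : List ℕ → List ℕ → ℕ → List ℕ
restrictType λ' f i =
  norm (map (λ j → countTrue (zipWith (λ l v → (l ≡ᵇ j) ∧ (v ≡ᵇ i)) (labels λ') f))
            (upTo (length λ')))

eqList : List ℕ → List ℕ → Bool
eqList []       []       = true
eqList []       (_ ∷ _)  = false
eqList (_ ∷ _)  []       = false
eqList (x ∷ xs) (y ∷ ys) = (x ≡ᵇ y) ∧ eqList xs ys

module WithRing {c ℓ} (R : CommutativeRing c ℓ) where
  open CommutativeRing R

  IsField : Set (c ⊔ ℓ)
  IsField = (¬ (1# ≈ 0#)) × (∀ x → ¬ (x ≈ 0#) → ∃ λ y → x * y ≈ 1#)

  natR : ℕ → Carrier
  natR zero    = 0#
  natR (suc n) = 1# + natR n

  sumR : List Carrier → Carrier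
  sumR = foldr _+_ 0#

  prodR : List Carrier → Carrier
  prodR = foldr _*_ 1#

  -- A symmetric function p = Σ_μ c_μ m_μ, given by its coefficients
  -- c_μ = p μ (only the values at partitions μ are meaningful).
  -- The coefficient of the monomial y^a (a a finite exponent vector)
  -- is p (norm a).
  SymFun : Set c
  SymFun = List ℕ → Carrier

  Homogeneous : ℕ → SymFun → Set ℓ
  Homogeneous n p = ∀ μ → IsPartition μ → ¬ (sum μ ≡ n) → p μ ≈ 0#

  ExactDegree : List ℕ → SymFun → Set ℓ
  ExactDegree λ' p =
    Homogeneous (sum λ') p
    × (¬ (p λ' ≈ 0#))
    × (∀ μ → IsPartition μ → sum μ ≡ sum λ' → RevLexGT μ λ' → p μ ≈ 0#)

  -- families indexed by partitions (values at non-partitions are ignored;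
  -- p_α for a vector α is p (norm α))
  FullSequence : (List ℕ → SymFun) → Set ℓ
  FullSequence p = ∀ λ' → IsPartition λ' → ExactDegree λ' (p λ')

  -- p_λ(y ∪ z) = Σ_α binom(λ,α) p_α(y) p_{λ-α}(z), compared coefficientwise
  -- at every monomial y^a z^b.
  BinomialType : (List ℕ → SymFun) → Set ℓ
  BinomialType p =
    ∀ λ' → IsPartition λ' → ∀ (a b : List ℕ) →
      p λ' (norm (a ++ b)) ≈
      sumR (map (λ α → natR (binomL λ' α)
                         * (p (norm α) (norm a) * p (norm (λ' -ᴸ α)) (norm b)))
                (boxes λ'))

  QuasiGenus : (List ℕ → Carrier) → Set ℓ
  QuasiGenus G = (G [] ≈ 1#) × (¬ (G (1 ∷ []) ≈ 0#))

  -- coefficient of y^a (a = (a_1,…,a_k)) in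
  -- Σ_{f : S → {1,2,…}} (∏_k G_{type(π|f⁻¹(k))}) ∏_s y_{f(s)}
  genericCoeff : (List ℕ → Carrier) → List ℕ → List ℕ → Carrier
  genericCoeff G λ' a =
    sumR (map (λ f → if eqList (fiberSizes (length a) f) a
                      then prodR (map (λ i → G (restrictType λ' f i)) (upTo (length a)))
                      else 0#)
              (allFuns (sum λ') (length a)))

  EnumeratesGeneric : (List ℕ → Carrier) → (List ℕ → SymFun) → Set ℓ
  EnumeratesGeneric G p =
    ∀ λ' → IsPartition λ' → ∀ (a : List ℕ) → p λ' (norm a) ≈ genericCoeff G λ' a

{-# OPTIONS --safe #-}
module Submission where

open import Defs
open import Level using (Level)
open import Algebra.Bundles using (CommutativeRing)
open import Data.Nat using (ℕ)
open import Data.List using (List)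
open import Data.Product using (_×_; ∃; _,_)

-- Label every element of S by its block, so that S is the list `labels λ` and a
-- function S → {1,…,k} is a colouring of that list.  Splitting the colours into
-- the first |a| and the remaining |b| ones splits a colouring of S into a
-- colouring of a sublist A and one of its complement; grouping the sublists by
-- the number αⱼ of elements they take from block j produces binom(λ, α), so the
-- generic coefficients satisfy the binomial identity, once one knows that they
-- depend on a partition only through its type.  Conversely, for a full sequence
-- of binomial type let G_μ be the coefficient of y₁^|μ| in p_μ.  The identity at
-- λ = ∅ gives p_∅ = p_∅², so G_∅ = 1 in a field, and expanding p_λ in its first
-- variable shows, by induction on the number of variables, that p_λ is the
-- generic coefficient.

module Normalisation where
  open import Data.Bool using (true; false)
  open import Data.Bool.Properties using (T-≡)
  open import Data.Empty using (⊥-elim)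
  open import Data.List using ([]; _∷_; foldr)
  open import Data.List.Relation.Binary.Permutation.Propositional as ↭ using (_↭_)
  open import Data.Nat using (zero; suc; _+_; _≤_; _<_; _≤ᵇ_; z≤n; s≤s)
  open import Data.Nat.ListAction using (sum)
  open import Data.Nat.Properties
    using (≤ᵇ-reflects-≤; ≤⇒≤ᵇ; _≤?_; ≰⇒>; <⇒≤; <⇒≱; ≤-trans; <-≤-trans; <-cmp; +-assoc; +-comm)
  open import Data.Product using (_,_)
  open import Data.Unit using (tt)
  open import Function using (_∘_)
  open import Function.Bundles using (Equivalence)
  open import Relation.Binary.Definitions using (tri<; tri≈; tri>)
  open import Relation.Binary.PropositionalEquality
  open import Relation.Nullary.Decidable using (yes; no)
  open import Relation.Nullary.Reflects using (ofʸ; ofⁿ)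

  ≤⇒≤ᵇ≡true : ∀ {m n} → m ≤ n → (m ≤ᵇ n) ≡ true
  ≤⇒≤ᵇ≡true = Equivalence.to T-≡ ∘ ≤⇒≤ᵇ

  >⇒≤ᵇ≡false : ∀ {m n} → n < m → (m ≤ᵇ n) ≡ false
  >⇒≤ᵇ≡false {m} {n} n<m with m ≤ᵇ n | ≤ᵇ-reflects-≤ m n
  ... | true  | ofʸ m≤n = ⊥-elim (<⇒≱ n<m m≤n)
  ... | false | _       = refl

  insertDesc-comm-< : ∀ {x y} → y < x → ∀ L → insertDesc x (insertDesc y L) ≡ insertDesc y (insertDesc x L)
  insertDesc-comm-< {x} {y} y<x []
    rewrite ≤⇒≤ᵇ≡true (<⇒≤ y<x) | >⇒≤ᵇ≡false y<x = refl
  insertDesc-comm-< {x} {y} y<x (z ∷ zs) with z ≤? y | z ≤? x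
  ... | yes z≤y | _
    rewrite ≤⇒≤ᵇ≡true z≤y | ≤⇒≤ᵇ≡true (≤-trans z≤y (<⇒≤ y<x))
          | ≤⇒≤ᵇ≡true (<⇒≤ y<x) | >⇒≤ᵇ≡false y<x | ≤⇒≤ᵇ≡true z≤y = refl
  ... | no z≰y | yes z≤x
    rewrite >⇒≤ᵇ≡false (≰⇒> z≰y) | ≤⇒≤ᵇ≡true z≤x | >⇒≤ᵇ≡false y<x
          | >⇒≤ᵇ≡false (≰⇒> z≰y) = refl
  ... | no z≰y | no z≰x
    rewrite >⇒≤ᵇ≡false (≰⇒> z≰y) | >⇒≤ᵇ≡false (≰⇒> z≰x)
          | >⇒≤ᵇ≡false (≰⇒> z≰y) =
    cong (z ∷_) (insertDesc-comm-< y<x zs)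

  insertDesc-comm : ∀ x y L → insertDesc x (insertDesc y L) ≡ insertDesc y (insertDesc x L)
  insertDesc-comm x y L with <-cmp x y
  ... | tri< x<y _ _    = sym (insertDesc-comm-< x<y L)
  ... | tri≈ _ refl _   = refl
  ... | tri> _ _ y<x    = insertDesc-comm-< y<x L

  norm-∷-cong : ∀ i {α α′} → norm α ≡ norm α′ → norm (i ∷ α) ≡ norm (i ∷ α′)
  norm-∷-cong zero    eq = eq
  norm-∷-cong (suc i) eq = cong (insertDesc (suc i)) eq

  norm-swap : ∀ i j α → norm (i ∷ j ∷ α) ≡ norm (j ∷ i ∷ α)
  norm-swap zero    zero    α = refl
  norm-swap zero    (suc j) α = refl
  norm-swap (suc i) zero    α = refl
  norm-swap (suc i) (suc j) α = insertDesc-comm (suc i) (suc j) (norm α)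

  insertDesc-↭ : ∀ x L → insertDesc x L ↭ x ∷ L
  insertDesc-↭ x []       = ↭.refl
  insertDesc-↭ x (y ∷ ys) with y ≤ᵇ x
  ... | true  = ↭.refl
  ... | false = ↭.trans (↭.prep y (insertDesc-↭ x ys)) (↭.swap y x ↭.refl)

  foldr-insertDesc-↭ : ∀ xs → foldr insertDesc [] xs ↭ xs
  foldr-insertDesc-↭ []       = ↭.refl
  foldr-insertDesc-↭ (x ∷ xs) = ↭.trans (insertDesc-↭ x _) (↭.prep x (foldr-insertDesc-↭ xs))

  sum-insertDesc : ∀ x L → sum (insertDesc x L) ≡ x + sum L
  sum-insertDesc x []       = refl
  sum-insertDesc x (y ∷ ys) with y ≤ᵇ x
  ... | true  = refl
  ... | false = begin
    y + sum (insertDesc x ys) ≡⟨ cong (y +_) (sum-insertDesc x ys) ⟩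
    y + (x + sum ys)          ≡⟨ sym (+-assoc y x _) ⟩
    y + x + sum ys            ≡⟨ cong (_+ sum ys) (+-comm y x) ⟩
    x + y + sum ys            ≡⟨ +-assoc x y _ ⟩
    x + (y + sum ys)          ∎
    where open ≡-Reasoning

  sum-norm : ∀ xs → sum (norm xs) ≡ sum xs
  sum-norm []           = refl
  sum-norm (zero ∷ xs)  = sum-norm xs
  sum-norm (suc x ∷ xs) = trans (sum-insertDesc (suc x) (norm xs)) (cong (suc x +_) (sum-norm xs))

  IsPartition-head>0 : ∀ x xs → IsPartition (x ∷ xs) → 0 < x
  IsPartition-head>0 x []       0<x         = 0<x
  IsPartition-head>0 x (y ∷ ys) (y≤x , isP) = <-≤-trans (IsPartition-head>0 y ys isP) y≤x

  IsPartition-tail : ∀ x xs → IsPartition (x ∷ xs) → IsPartition xs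
  IsPartition-tail x []       _         = tt
  IsPartition-tail x (y ∷ ys) (_ , isP) = isP

  IsPartition-insertDesc-below : ∀ {x} y L → 0 < x → x ≤ y → IsPartition (y ∷ L) → IsPartition (y ∷ insertDesc x L)
  IsPartition-insertDesc-below y []       0<x x≤y _ = x≤y , 0<x
  IsPartition-insertDesc-below {x} y (z ∷ zs) 0<x x≤y (z≤y , isP) with z ≤ᵇ x | ≤ᵇ-reflects-≤ z x
  ... | true  | ofʸ z≤x = x≤y , z≤x , isP
  ... | false | ofⁿ z≰x = z≤y , IsPartition-insertDesc-below z zs 0<x (<⇒≤ (≰⇒> z≰x)) isP

  IsPartition-insertDesc : ∀ x L → 0 < x → IsPartition L → IsPartition (insertDesc x L)
  IsPartition-insertDesc x []       0<x _ = 0<x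
  IsPartition-insertDesc x (y ∷ ys) 0<x isP with y ≤ᵇ x | ≤ᵇ-reflects-≤ y x
  ... | true  | ofʸ y≤x = y≤x , isP
  ... | false | ofⁿ y≰x = IsPartition-insertDesc-below y ys 0<x (<⇒≤ (≰⇒> y≰x)) isP

  IsPartition-norm : ∀ xs → IsPartition (norm xs)
  IsPartition-norm []           = tt
  IsPartition-norm (zero ∷ xs)  = IsPartition-norm xs
  IsPartition-norm (suc x ∷ xs) = IsPartition-insertDesc (suc x) (norm xs) (s≤s z≤n) (IsPartition-norm xs)

  dropZeros-partition : ∀ xs → IsPartition xs → dropZeros xs ≡ xs
  dropZeros-partition []           _   = refl
  dropZeros-partition (zero ∷ xs)  isP with () ← IsPartition-head>0 0 xs isP
  dropZeros-partition (suc x ∷ xs) isP = cong (suc x ∷_) (dropZeros-partition xs (IsPartition-tail _ xs isP))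

  foldr-insertDesc-partition : ∀ xs → IsPartition xs → foldr insertDesc [] xs ≡ xs
  foldr-insertDesc-partition []           _ = refl
  foldr-insertDesc-partition (x ∷ [])     _ = refl
  foldr-insertDesc-partition (x ∷ y ∷ ys) (y≤x , isP)
    rewrite foldr-insertDesc-partition (y ∷ ys) isP | ≤⇒≤ᵇ≡true y≤x = refl

  norm-partition : ∀ xs → IsPartition xs → norm xs ≡ xs
  norm-partition xs isP =
    trans (cong (foldr insertDesc []) (dropZeros-partition xs isP)) (foldr-insertDesc-partition xs isP)

  norm-idem : ∀ xs → norm (norm xs) ≡ norm xs
  norm-idem xs = norm-partition (norm xs) (IsPartition-norm xs)

open Normalisation

module BlockLabels where
  open import Data.Bool using (true; false; if_then_else_; _∧_)
  open import Data.List using (List; []; _∷_; _++_; map; upTo; applyUpTo; replicate; length; zipWith)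
  import Data.List.Properties as List
  open import Data.Nat using (ℕ; zero; suc; _+_; _<_; _≡ᵇ_; s≤s)
  open import Data.Nat.ListAction using (sum)
  open import Data.Nat.Properties using (+-identityʳ; suc-injective)
  open import Function using (id)
  open import Relation.Binary.PropositionalEquality

  occurrences : ℕ → List ℕ → ℕ
  occurrences j M = countTrue (map (_≡ᵇ j) M)

  occurrenceVector : ℕ → List ℕ → List ℕ
  occurrenceVector m M = map (λ j → occurrences j M) (upTo m)

  length-labelsFrom : ∀ j xs → length (labelsFrom j xs) ≡ sum xs
  length-labelsFrom j []       = refl
  length-labelsFrom j (x ∷ xs) =
    trans (List.length-++ (replicate x j)) (cong₂ _+_ (List.length-replicate x) (length-labelsFrom (suc j) xs))

  labelsFrom-suc : ∀ j xs → labelsFrom (suc j) xs ≡ map suc (labelsFrom j xs)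
  labelsFrom-suc j []       = refl
  labelsFrom-suc j (x ∷ xs) = begin
    replicate x (suc j) ++ labelsFrom (suc (suc j)) xs
      ≡⟨ cong₂ _++_ (sym (List.map-replicate suc x j)) (labelsFrom-suc (suc j) xs) ⟩
    map suc (replicate x j) ++ map suc (labelsFrom (suc j) xs)
      ≡⟨ sym (List.map-++ suc (replicate x j) _) ⟩
    map suc (replicate x j ++ labelsFrom (suc j) xs) ∎
    where open ≡-Reasoning

  occurrences-++ : ∀ j A B → occurrences j (A ++ B) ≡ occurrences j A + occurrences j B
  occurrences-++ j []      B = refl
  occurrences-++ j (l ∷ A) B with l ≡ᵇ j
  ... | true  = cong suc (occurrences-++ j A B)
  ... | false = occurrences-++ j A B

  ≡ᵇ-refl : ∀ j → (j ≡ᵇ j) ≡ true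
  ≡ᵇ-refl zero    = refl
  ≡ᵇ-refl (suc j) = ≡ᵇ-refl j

  occurrences-replicate : ∀ j x → occurrences j (replicate x j) ≡ x
  occurrences-replicate j zero    = refl
  occurrences-replicate j (suc x) rewrite ≡ᵇ-refl j = cong suc (occurrences-replicate j x)

  occurrences-suc-replicate-zero : ∀ j x → occurrences (suc j) (replicate x 0) ≡ 0
  occurrences-suc-replicate-zero j zero    = refl
  occurrences-suc-replicate-zero j (suc x) = occurrences-suc-replicate-zero j x

  occurrences-zero-map-suc : ∀ L → occurrences 0 (map suc L) ≡ 0
  occurrences-zero-map-suc []      = refl
  occurrences-zero-map-suc (l ∷ L) = occurrences-zero-map-suc L

  occurrences-suc-map-suc : ∀ j L → occurrences (suc j) (map suc L) ≡ occurrences j L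
  occurrences-suc-map-suc j []      = refl
  occurrences-suc-map-suc j (l ∷ L) with l ≡ᵇ j
  ... | true  = cong suc (occurrences-suc-map-suc j L)
  ... | false = occurrences-suc-map-suc j L

  occurrenceVector-labels : ∀ xs → occurrenceVector (length xs) (labels xs) ≡ xs
  occurrenceVector-labels []       = refl
  occurrenceVector-labels (x ∷ xs) = cong₂ _∷_ occurrences-head (begin
    map (λ j → occurrences j L) (applyUpTo suc (length xs))  ≡⟨ List.map-applyUpTo suc _ (length xs) ⟩
    applyUpTo (λ j → occurrences (suc j) L) (length xs)      ≡⟨ List.map-applyUpTo id _ (length xs) ⟨
    map (λ j → occurrences (suc j) L) (upTo (length xs))    ≡⟨ List.map-cong occurrences-tail (upTo (length xs)) ⟩
    occurrenceVector (length xs) (labels xs)                 ≡⟨ occurrenceVector-labels xs ⟩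
    xs                                                       ∎)
    where
    open ≡-Reasoning
    L : List ℕ
    L = replicate x 0 ++ labelsFrom 1 xs
    occurrences-head : occurrences 0 L ≡ x
    occurrences-head = begin
      occurrences 0 L
        ≡⟨ occurrences-++ 0 (replicate x 0) _ ⟩
      occurrences 0 (replicate x 0) + occurrences 0 (labelsFrom 1 xs)
        ≡⟨ cong₂ _+_ (occurrences-replicate 0 x) (cong (occurrences 0) (labelsFrom-suc 0 xs)) ⟩
      x + occurrences 0 (map suc (labels xs))
        ≡⟨ cong (x +_) (occurrences-zero-map-suc (labels xs)) ⟩
      x + 0
        ≡⟨ +-identityʳ x ⟩
      x ∎
    occurrences-tail : ∀ j → occurrences (suc j) L ≡ occurrences j (labels xs)
    occurrences-tail j = begin
      occurrences (suc j) L
        ≡⟨ occurrences-++ (suc j) (replicate x 0) _ ⟩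
      occurrences (suc j) (replicate x 0) + occurrences (suc j) (labelsFrom 1 xs)
        ≡⟨ cong₂ _+_ (occurrences-suc-replicate-zero j x) (cong (occurrences (suc j)) (labelsFrom-suc 0 xs)) ⟩
      occurrences (suc j) (map suc (labels xs))
        ≡⟨ occurrences-suc-map-suc j (labels xs) ⟩
      occurrences j (labels xs) ∎

  fiber : List ℕ → List ℕ → ℕ → List ℕ
  fiber (l ∷ L) (v ∷ f) i = if v ≡ᵇ i then l ∷ fiber L f i else fiber L f i
  fiber _       _       i = []

  length-fiber : ∀ L f i → length f ≡ length L → countTrue (map (_≡ᵇ i) f) ≡ length (fiber L f i)
  length-fiber []      []      i _  = refl
  length-fiber (l ∷ L) (v ∷ f) i eq with v ≡ᵇ i
  ... | true  = cong suc (length-fiber L f i (suc-injective eq))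
  ... | false = length-fiber L f i (suc-injective eq)

  occurrences-fiber : ∀ L f i j →
    countTrue (zipWith (λ l v → (l ≡ᵇ j) ∧ (v ≡ᵇ i)) L f) ≡ occurrences j (fiber L f i)
  occurrences-fiber []      f       i j = refl
  occurrences-fiber (l ∷ L) []      i j = refl
  occurrences-fiber (l ∷ L) (v ∷ f) i j with v ≡ᵇ i
  ... | true with l ≡ᵇ j
  ...   | true  = cong suc (occurrences-fiber L f i j)
  ...   | false = occurrences-fiber L f i j
  occurrences-fiber (l ∷ L) (v ∷ f) i j | false with l ≡ᵇ j
  ...   | true  = occurrences-fiber L f i j
  ...   | false = occurrences-fiber L f i j

  nth : List ℕ → ℕ → ℕ
  nth []       i       = 0
  nth (x ∷ a) zero    = x
  nth (x ∷ a) (suc i) = nth a i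

  nth-++ˡ : ∀ a b {i} → i < length a → nth (a ++ b) i ≡ nth a i
  nth-++ˡ (x ∷ a) b {zero}  _         = refl
  nth-++ˡ (x ∷ a) b {suc i} (s≤s i<) = nth-++ˡ a b i<

  nth-++ʳ : ∀ a b i → nth (a ++ b) (length a + i) ≡ nth b i
  nth-++ʳ []      b i = refl
  nth-++ʳ (x ∷ a) b i = nth-++ʳ a b i

open BlockLabels

module GenericCoefficients {c ℓ} (R : CommutativeRing c ℓ) where
  open import Data.Bool using (true; false; T; if_then_else_)
  open import Data.Empty using (⊥-elim)
  open import Data.Fin using (toℕ)
  open import Data.Fin.Properties using (toℕ<n; toℕ-inject₁; toℕ-fromℕ)
  open import Data.List using ([]; _∷_; _++_; map; concatMap; upTo; applyUpTo; replicate; length; foldr)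
  import Data.List.Properties as List
  open import Data.List.Relation.Binary.Permutation.Propositional as ↭ using (_↭_)
  open import Data.Nat as ℕ using (zero; suc; _∸_; _<_; _≡ᵇ_; z≤n; s≤s)
  open import Data.Nat.Combinatorics using (_C_; k>n⇒nCk≡0; nCk+nC[k+1]≡[n+1]C[k+1])
  open import Data.Nat.ListAction using (sum)
  open import Data.Nat.Properties as ℕ using (≡ᵇ⇒≡; ≡⇒≡ᵇ; <⇒≢; <-≤-trans; m≤m+n; n<1+n; +-∸-assoc)
  open import Data.Product using (proj₁; proj₂)
  open import Data.Unit using (tt)
  import Data.Vec.Functional as Vector
  open import Function using (_∘_; id)
  open import Level using (_⊔_)
  open import Relation.Binary.PropositionalEquality as ≡ using (_≡_; _≢_)
  open import Relation.Nullary using (¬_)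

  open CommutativeRing R
  open WithRing R
  open import Relation.Binary.Reasoning.Setoid setoid
  open import Algebra.Properties.Semiring.Sum semiring
    using (sum-cong-≋; sum-cong-≗; ∑-distrib-+; ∑-comm; *-distribˡ-sum; *-distribʳ-sum; sum-init-last)
    renaming (sum to sumᵛ)
  open import Algebra.Properties.CommutativeMonoid.Sum *-commutativeMonoid
    using () renaming (sum to productᵛ; sum-cong-≋ to productᵛ-cong-≋)
  open import Algebra.Properties.Semiring.Mult semiring using (×-homo-+; ×1-homo-*) renaming (_×_ to _·_)
  open import Algebra.Properties.CommutativeSemigroup +-commutativeSemigroup using (x∙yz≈y∙xz)
  open import Algebra.Properties.CommutativeSemigroup *-commutativeSemigroup
    using () renaming (x∙yz≈y∙xz to x*yz≈y*xz)

  -- Finite sums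

  -- Definitionally, sumUpTo (suc k) f = f 0 + sumUpTo k (f ∘ suc).
  sumUpTo : ℕ → (ℕ → Carrier) → Carrier
  sumUpTo k f = sumᵛ {k} (f ∘ toℕ)

  productUpTo : ℕ → (ℕ → Carrier) → Carrier
  productUpTo k f = productᵛ {k} (f ∘ toℕ)

  sumUpTo-cong : ∀ k {f g : ℕ → Carrier} → (∀ i → i < k → f i ≈ g i) → sumUpTo k f ≈ sumUpTo k g
  sumUpTo-cong k f≈g = sum-cong-≋ (λ i → f≈g (toℕ i) (toℕ<n i))

  productUpTo-cong : ∀ k {f g : ℕ → Carrier} → (∀ i → i < k → f i ≈ g i) → productUpTo k f ≈ productUpTo k g
  productUpTo-cong k f≈g = productᵛ-cong-≋ (λ i → f≈g (toℕ i) (toℕ<n i))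

  sumUpTo-distrib-+ : ∀ k (f g : ℕ → Carrier) → sumUpTo k (λ i → f i + g i) ≈ sumUpTo k f + sumUpTo k g
  sumUpTo-distrib-+ k f g = ∑-distrib-+ {k} (f ∘ toℕ) (g ∘ toℕ)

  *-distribˡ-sumUpTo : ∀ k a (f : ℕ → Carrier) → a * sumUpTo k f ≈ sumUpTo k (λ i → a * f i)
  *-distribˡ-sumUpTo k a f = *-distribˡ-sum {k} a (f ∘ toℕ)

  *-distribʳ-sumUpTo : ∀ k a (f : ℕ → Carrier) → sumUpTo k f * a ≈ sumUpTo k (λ i → f i * a)
  *-distribʳ-sumUpTo k a f = *-distribʳ-sum {k} a (f ∘ toℕ)

  sumUpTo-comm : ∀ m n (f : ℕ → ℕ → Carrier) →
    sumUpTo m (λ i → sumUpTo n (f i)) ≈ sumUpTo n (λ j → sumUpTo m (λ i → f i j))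
  sumUpTo-comm m n f = ∑-comm {m} {n} (λ i j → f (toℕ i) (toℕ j))

  sumUpTo-+ : ∀ m n (f : ℕ → Carrier) →
    sumUpTo (m ℕ.+ n) f ≈ sumUpTo m f + sumUpTo n (λ i → f (m ℕ.+ i))
  sumUpTo-+ zero    n f = sym (+-identityˡ _)
  sumUpTo-+ (suc m) n f = trans (+-congˡ (sumUpTo-+ m n (f ∘ suc))) (sym (+-assoc _ _ _))

  productUpTo-+ : ∀ m n (f : ℕ → Carrier) →
    productUpTo (m ℕ.+ n) f ≈ productUpTo m f * productUpTo n (λ i → f (m ℕ.+ i))
  productUpTo-+ zero    n f = sym (*-identityˡ _)
  productUpTo-+ (suc m) n f = trans (*-congˡ (productUpTo-+ m n (f ∘ suc))) (sym (*-assoc _ _ _))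

  sumUpTo-last : ∀ k (f : ℕ → Carrier) → sumUpTo (suc k) f ≈ sumUpTo k f + f k
  sumUpTo-last k f = trans (sum-init-last {k} (f ∘ toℕ))
    (+-cong (reflexive (sum-cong-≗ {k} (≡.cong f ∘ toℕ-inject₁))) (reflexive (≡.cong f (toℕ-fromℕ k))))

  foldr-applyUpTo : (_∙_ : Carrier → Carrier → Carrier) (e : Carrier) (k : ℕ) (f : ℕ → Carrier) →
                    foldr _∙_ e (applyUpTo f k) ≡ Vector.foldr _∙_ e (f ∘ toℕ {k})
  foldr-applyUpTo _∙_ e zero    f = ≡.refl
  foldr-applyUpTo _∙_ e (suc k) f = ≡.cong (f 0 ∙_) (foldr-applyUpTo _∙_ e k (f ∘ suc))

  sumR-map-upTo : ∀ k (f : ℕ → Carrier) → sumR (map f (upTo k)) ≡ sumUpTo k f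
  sumR-map-upTo k f = ≡.trans (≡.cong sumR (List.map-applyUpTo id f k)) (foldr-applyUpTo _+_ 0# k f)

  prodR-map-upTo : ∀ k (f : ℕ → Carrier) → prodR (map f (upTo k)) ≡ productUpTo k f
  prodR-map-upTo k f = ≡.trans (≡.cong prodR (List.map-applyUpTo id f k)) (foldr-applyUpTo _*_ 1# k f)

  sumR-++ : ∀ xs ys → sumR (xs ++ ys) ≈ sumR xs + sumR ys
  sumR-++ []       ys = sym (+-identityˡ _)
  sumR-++ (x ∷ xs) ys = trans (+-congˡ (sumR-++ xs ys)) (sym (+-assoc _ _ _))

  sumR-map-cong : ∀ {A : Set} {F H : A → Carrier} xs →
    (∀ x → F x ≈ H x) → sumR (map F xs) ≈ sumR (map H xs)
  sumR-map-cong []       F≈H = refl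
  sumR-map-cong (x ∷ xs) F≈H = +-cong (F≈H x) (sumR-map-cong xs F≈H)

  sumR-map-*ˡ : ∀ {A : Set} a (F : A → Carrier) xs → sumR (map (λ x → a * F x) xs) ≈ a * sumR (map F xs)
  sumR-map-*ˡ a F []       = sym (zeroʳ a)
  sumR-map-*ˡ a F (x ∷ xs) = trans (+-congˡ (sumR-map-*ˡ a F xs)) (sym (distribˡ a _ _))

  sumR-map-concatMap : ∀ {A B : Set} (F : B → Carrier) (g : A → List B) xs →
                       sumR (map F (concatMap g xs)) ≈ sumR (map (sumR ∘ map F ∘ g) xs)
  sumR-map-concatMap F g []       = refl
  sumR-map-concatMap F g (x ∷ xs) = begin
    sumR (map F (g x ++ concatMap g xs))                  ≡⟨ ≡.cong sumR (List.map-++ F (g x) _) ⟩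
    sumR (map F (g x) ++ map F (concatMap g xs))          ≈⟨ sumR-++ (map F (g x)) _ ⟩
    sumR (map F (g x)) + sumR (map F (concatMap g xs))    ≈⟨ +-congˡ (sumR-map-concatMap F g xs) ⟩
    sumR (map F (g x)) + sumR (map (sumR ∘ map F ∘ g) xs) ∎

  sumR-map-prepend-upTo : ∀ (F : List ℕ → Carrier) k L →
    sumR (map F (concatMap (λ v → map (v ∷_) L) (upTo k)))
      ≈ sumUpTo k (λ v → sumR (map (λ α → F (v ∷ α)) L))
  sumR-map-prepend-upTo F k L = begin
    sumR (map F (concatMap (λ v → map (v ∷_) L) (upTo k)))
      ≈⟨ sumR-map-concatMap F _ (upTo k) ⟩
    sumR (map (λ v → sumR (map F (map (v ∷_) L))) (upTo k))
      ≡⟨ sumR-map-upTo k _ ⟩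
    sumUpTo k (λ v → sumR (map F (map (v ∷_) L)))
      ≡⟨ sum-cong-≗ {k} (λ v → ≡.cong sumR (≡.sym (List.map-∘ L))) ⟩
    sumUpTo k (λ v → sumR (map (λ α → F (v ∷ α)) L)) ∎

  natR≡·1# : ∀ n → natR n ≡ n · 1#
  natR≡·1# zero    = ≡.refl
  natR≡·1# (suc n) = ≡.cong (1# +_) (natR≡·1# n)

  natR-1-* : ∀ x → natR 1 * x ≈ x
  natR-1-* x = trans (*-congʳ (+-identityʳ 1#)) (*-identityˡ x)

  natR-+ : ∀ m n → natR (m ℕ.+ n) ≈ natR m + natR n
  natR-+ m n = begin
    natR (m ℕ.+ n)      ≡⟨ natR≡·1# (m ℕ.+ n) ⟩
    (m ℕ.+ n) · 1#      ≈⟨ ×-homo-+ 1# m n ⟩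
    m · 1# + n · 1#     ≡⟨ ≡.cong₂ _+_ (natR≡·1# m) (natR≡·1# n) ⟨
    natR m + natR n     ∎

  natR-* : ∀ m n → natR (m ℕ.* n) ≈ natR m * natR n
  natR-* m n = begin
    natR (m ℕ.* n)      ≡⟨ natR≡·1# (m ℕ.* n) ⟩
    (m ℕ.* n) · 1#      ≈⟨ ×1-homo-* m n ⟩
    (m · 1#) * (n · 1#) ≡⟨ ≡.cong₂ _*_ (natR≡·1# m) (natR≡·1# n) ⟨
    natR m * natR n     ∎

  -- Splitting a list in two, and binomially weighted sums over boxes

  sumSplits : List ℕ → (List ℕ → List ℕ → Carrier) → Carrier
  sumSplits []      Φ = Φ [] []
  sumSplits (l ∷ L) Φ = sumSplits L (λ A B → Φ (l ∷ A) B) + sumSplits L (λ A B → Φ A (l ∷ B))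

  sumSplits-cong : ∀ L {Φ Ψ : List ℕ → List ℕ → Carrier} →
    (∀ A B → Φ A B ≈ Ψ A B) → sumSplits L Φ ≈ sumSplits L Ψ
  sumSplits-cong []      Φ≈Ψ = Φ≈Ψ [] []
  sumSplits-cong (l ∷ L) Φ≈Ψ =
    +-cong (sumSplits-cong L (λ A → Φ≈Ψ (l ∷ A))) (sumSplits-cong L (λ A B → Φ≈Ψ A (l ∷ B)))

  sumUpTo-sumSplits : ∀ L k (Φ : ℕ → List ℕ → List ℕ → Carrier) →
    sumUpTo k (λ v → sumSplits L (Φ v)) ≈ sumSplits L (λ A B → sumUpTo k (λ v → Φ v A B))
  sumUpTo-sumSplits []      k Φ = refl
  sumUpTo-sumSplits (l ∷ L) k Φ = trans
    (sumUpTo-distrib-+ k (λ v → sumSplits L (Φˡ v)) (λ v → sumSplits L (Φʳ v)))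
    (+-cong (sumUpTo-sumSplits L k Φˡ) (sumUpTo-sumSplits L k Φʳ))
    where
    Φˡ Φʳ : ℕ → List ℕ → List ℕ → Carrier
    Φˡ v A B = Φ v (l ∷ A) B
    Φʳ v A B = Φ v A (l ∷ B)

  sumSplits-++ : ∀ L₁ L₂ (Φ : List ℕ → List ℕ → Carrier) →
    sumSplits (L₁ ++ L₂) Φ ≡ sumSplits L₁ (λ A₁ B₁ → sumSplits L₂ (λ A₂ B₂ → Φ (A₁ ++ A₂) (B₁ ++ B₂)))
  sumSplits-++ []       L₂ Φ = ≡.refl
  sumSplits-++ (l ∷ L₁) L₂ Φ = ≡.cong₂ _+_ (sumSplits-++ L₁ L₂ _) (sumSplits-++ L₁ L₂ _)

  sumBox : List ℕ → (List ℕ → List ℕ → Carrier) → Carrier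
  sumBox []       Ψ = Ψ [] []
  sumBox (x ∷ xs) Ψ =
    sumUpTo (suc x) (λ i → natR (x C i) * sumBox xs (λ α β → Ψ (i ∷ α) ((x ∸ i) ∷ β)))

  sumBox-cong-length : ∀ xs {Ψ Ψ′ : List ℕ → List ℕ → Carrier} →
    (∀ α β → length α ≡ length xs → length β ≡ length xs → Ψ α β ≈ Ψ′ α β) →
    sumBox xs Ψ ≈ sumBox xs Ψ′
  sumBox-cong-length []       Ψ≈Ψ′ = Ψ≈Ψ′ [] [] ≡.refl ≡.refl
  sumBox-cong-length (x ∷ xs) Ψ≈Ψ′ = sumUpTo-cong (suc x) λ i _ →
    *-congˡ {natR (x C i)} (sumBox-cong-length xs λ α β |α| |β| →
      Ψ≈Ψ′ (i ∷ α) ((x ∸ i) ∷ β) (≡.cong suc |α|) (≡.cong suc |β|))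

  sumBox-cong : ∀ xs {Ψ Ψ′ : List ℕ → List ℕ → Carrier} →
    (∀ α β → Ψ α β ≈ Ψ′ α β) → sumBox xs Ψ ≈ sumBox xs Ψ′
  sumBox-cong xs Ψ≈Ψ′ = sumBox-cong-length xs (λ α β _ _ → Ψ≈Ψ′ α β)

  sumR-boxes : ∀ xs (Ψ : List ℕ → List ℕ → Carrier) →
    sumR (map (λ α → natR (binomL xs α) * Ψ α (xs -ᴸ α)) (boxes xs)) ≈ sumBox xs Ψ
  sumR-boxes []       Ψ = trans (+-identityʳ _) (natR-1-* (Ψ [] []))
  sumR-boxes (x ∷ xs) Ψ = begin
    sumR (map (λ α → natR (binomL (x ∷ xs) α) * Ψ α ((x ∷ xs) -ᴸ α)) (boxes (x ∷ xs)))
      ≈⟨ sumR-map-prepend-upTo _ (suc x) (boxes xs) ⟩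
    sumUpTo (suc x) (λ i → sumR (map (λ α → natR ((x C i) ℕ.* binomL xs α) * Ψᵢ i α (xs -ᴸ α)) (boxes xs)))
      ≈⟨ sumUpTo-cong (suc x) (λ i _ → begin
           sumR (map (λ α → natR ((x C i) ℕ.* binomL xs α) * Ψᵢ i α (xs -ᴸ α)) (boxes xs))
             ≈⟨ sumR-map-cong (boxes xs) (λ α → trans (*-congʳ (natR-* (x C i) _)) (*-assoc _ _ _)) ⟩
           sumR (map (λ α → natR (x C i) * (natR (binomL xs α) * Ψᵢ i α (xs -ᴸ α))) (boxes xs))
             ≈⟨ sumR-map-*ˡ _ _ (boxes xs) ⟩
           natR (x C i) * sumR (map (λ α → natR (binomL xs α) * Ψᵢ i α (xs -ᴸ α)) (boxes xs))
             ≈⟨ *-congˡ (sumR-boxes xs (Ψᵢ i)) ⟩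
           natR (x C i) * sumBox xs (Ψᵢ i) ∎) ⟩
    sumBox (x ∷ xs) Ψ ∎
    where
    Ψᵢ : ℕ → List ℕ → List ℕ → Carrier
    Ψᵢ i α β = Ψ (i ∷ α) ((x ∸ i) ∷ β)

  sumUpTo-pascal : ∀ x (g : ℕ → ℕ → Carrier) →
    sumUpTo (suc x) (λ i → natR (x C i) * g (suc i) (x ∸ i))
      + sumUpTo (suc x) (λ i → natR (x C i) * g i (suc (x ∸ i)))
      ≈ sumUpTo (suc (suc x)) (λ i → natR (suc x C i) * g i (suc x ∸ i))
  sumUpTo-pascal x g = begin
    S₁ + (g₀ + sumUpTo x (λ i → natR (x C suc i) * g (suc i) (suc (x ∸ suc i))))
      ≈⟨ +-congˡ (+-congˡ (sumUpTo-cong x (λ i i<x →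
           *-congˡ {natR (x C suc i)} (reflexive (≡.cong (g (suc i)) (≡.sym (+-∸-assoc 1 i<x))))))) ⟩
    S₁ + (g₀ + sumUpTo x shifted)
      ≈⟨ +-congˡ (+-congˡ (sym (trans (sumUpTo-last x shifted) last-vanishes))) ⟩
    S₁ + (g₀ + sumUpTo (suc x) shifted)
      ≈⟨ x∙yz≈y∙xz S₁ g₀ _ ⟩
    g₀ + (S₁ + sumUpTo (suc x) shifted)
      ≈⟨ +-congˡ (sym (sumUpTo-distrib-+ (suc x) (λ i → natR (x C i) * g (suc i) (x ∸ i)) shifted)) ⟩
    g₀ + sumUpTo (suc x) (λ i → natR (x C i) * g (suc i) (x ∸ i) + shifted i)
      ≈⟨ +-congˡ (sumUpTo-cong (suc x) (λ i _ → pascal i)) ⟩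
    g₀ + sumUpTo (suc x) (λ i → natR (suc x C suc i) * g (suc i) (x ∸ i)) ∎
    where
    S₁ g₀ : Carrier
    S₁ = sumUpTo (suc x) (λ i → natR (x C i) * g (suc i) (x ∸ i))
    g₀ = natR 1 * g 0 (suc x)
    shifted : ℕ → Carrier
    shifted i = natR (x C suc i) * g (suc i) (x ∸ i)
    last-vanishes : sumUpTo x shifted + shifted x ≈ sumUpTo x shifted
    last-vanishes = trans
      (+-congˡ (trans (*-congʳ (reflexive (≡.cong natR (k>n⇒nCk≡0 (n<1+n x))))) (zeroˡ _)))
      (+-identityʳ _)
    pascal : ∀ i → natR (x C i) * g (suc i) (x ∸ i) + shifted i
                     ≈ natR (suc x C suc i) * g (suc i) (x ∸ i)
    pascal i = begin
      natR (x C i) * gᵢ + natR (x C suc i) * gᵢ ≈⟨ distribʳ gᵢ _ _ ⟨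
      (natR (x C i) + natR (x C suc i)) * gᵢ    ≈⟨ *-congʳ (natR-+ (x C i) (x C suc i)) ⟨
      natR (x C i ℕ.+ x C suc i) * gᵢ           ≡⟨ ≡.cong (λ n → natR n * gᵢ) (nCk+nC[k+1]≡[n+1]C[k+1] x i) ⟩
      natR (suc x C suc i) * gᵢ                 ∎
      where
      gᵢ : Carrier
      gᵢ = g (suc i) (x ∸ i)

  sumSplits-replicate : ∀ x j (Φ : List ℕ → List ℕ → Carrier) →
    sumSplits (replicate x j) Φ
      ≈ sumUpTo (suc x) (λ i → natR (x C i) * Φ (replicate i j) (replicate (x ∸ i) j))
  sumSplits-replicate zero    j Φ = sym (trans (+-identityʳ _) (natR-1-* (Φ [] [])))
  sumSplits-replicate (suc x) j Φ = trans
    (+-cong (sumSplits-replicate x j _) (sumSplits-replicate x j _))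
    (sumUpTo-pascal x (λ i k → Φ (replicate i j) (replicate k j)))

  sumSplits-labelsFrom : ∀ xs j (Φ : List ℕ → List ℕ → Carrier) →
    sumSplits (labelsFrom j xs) Φ ≈ sumBox xs (λ α β → Φ (labelsFrom j α) (labelsFrom j β))
  sumSplits-labelsFrom []       j Φ = refl
  sumSplits-labelsFrom (x ∷ xs) j Φ = begin
    sumSplits (replicate x j ++ labelsFrom (suc j) xs) Φ
      ≡⟨ sumSplits-++ (replicate x j) _ Φ ⟩
    sumSplits (replicate x j) (λ A B → sumSplits (labelsFrom (suc j) xs) (λ A′ B′ → Φ (A ++ A′) (B ++ B′)))
      ≈⟨ sumSplits-replicate x j _ ⟩
    sumUpTo (suc x) (λ i → natR (x C i) * sumSplits (labelsFrom (suc j) xs) (Φᵢ i))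
      ≈⟨ sumUpTo-cong (suc x) (λ i _ → *-congˡ {natR (x C i)} (sumSplits-labelsFrom xs (suc j) (Φᵢ i))) ⟩
    sumBox (x ∷ xs) (λ α β → Φ (labelsFrom j α) (labelsFrom j β)) ∎
    where
    Φᵢ : ℕ → List ℕ → List ℕ → Carrier
    Φᵢ i A′ B′ = Φ (replicate i j ++ A′) (replicate (x ∸ i) j ++ B′)

  NormInvariant : (List ℕ → List ℕ → Carrier) → Set ℓ
  NormInvariant Ψ = ∀ α α′ β β′ → norm α ≡ norm α′ → norm β ≡ norm β′ → Ψ α β ≈ Ψ α′ β′

  NormInvariant-∷ : ∀ {Ψ} i j → NormInvariant Ψ → NormInvariant (λ α β → Ψ (i ∷ α) (j ∷ β))
  NormInvariant-∷ i j inv α α′ β β′ α∼α′ β∼β′ = inv _ _ _ _ (norm-∷-cong i α∼α′) (norm-∷-cong j β∼β′)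

  SumBoxEquivalent : List ℕ → List ℕ → Set (c ⊔ ℓ)
  SumBoxEquivalent xs ys = ∀ Ψ → NormInvariant Ψ → sumBox xs Ψ ≈ sumBox ys Ψ

  sumBox-∷ : ∀ x xs ys → SumBoxEquivalent xs ys → SumBoxEquivalent (x ∷ xs) (x ∷ ys)
  sumBox-∷ x xs ys xs≈ys Ψ inv = sumUpTo-cong (suc x) λ i _ →
    *-congˡ {natR (x C i)} (xs≈ys (λ α β → Ψ (i ∷ α) ((x ∸ i) ∷ β)) (NormInvariant-∷ {Ψ} i (x ∸ i) inv))

  sumBox-swap : ∀ x y xs → SumBoxEquivalent (x ∷ y ∷ xs) (y ∷ x ∷ xs)
  sumBox-swap x y xs Ψ inv = begin
    sumUpTo (suc x) (λ i → natR (x C i) * sumUpTo (suc y) (λ j → natR (y C j) * Ψ₁ i j))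
      ≈⟨ sumUpTo-cong (suc x) (λ i _ → *-distribˡ-sumUpTo (suc y) (natR (x C i)) (λ j → natR (y C j) * Ψ₁ i j)) ⟩
    sumUpTo (suc x) (λ i → sumUpTo (suc y) (λ j → natR (x C i) * (natR (y C j) * Ψ₁ i j)))
      ≈⟨ sumUpTo-comm (suc x) (suc y) (λ i j → natR (x C i) * (natR (y C j) * Ψ₁ i j)) ⟩
    sumUpTo (suc y) (λ j → sumUpTo (suc x) (λ i → natR (x C i) * (natR (y C j) * Ψ₁ i j)))
      ≈⟨ sumUpTo-cong (suc y) (λ j _ → sumUpTo-cong (suc x) (λ i _ → reorder i j)) ⟩
    sumUpTo (suc y) (λ j → sumUpTo (suc x) (λ i → natR (y C j) * (natR (x C i) * Ψ₂ j i)))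
      ≈⟨ sumUpTo-cong (suc y) (λ j _ → *-distribˡ-sumUpTo (suc x) (natR (y C j)) (λ i → natR (x C i) * Ψ₂ j i)) ⟨
    sumUpTo (suc y) (λ j → natR (y C j) * sumUpTo (suc x) (λ i → natR (x C i) * Ψ₂ j i)) ∎
    where
    Ψ₁ : ℕ → ℕ → Carrier
    Ψ₁ i j = sumBox xs (λ α β → Ψ (i ∷ j ∷ α) ((x ∸ i) ∷ (y ∸ j) ∷ β))
    Ψ₂ : ℕ → ℕ → Carrier
    Ψ₂ j i = sumBox xs (λ α β → Ψ (j ∷ i ∷ α) ((y ∸ j) ∷ (x ∸ i) ∷ β))
    reorder : ∀ i j → natR (x C i) * (natR (y C j) * Ψ₁ i j) ≈ natR (y C j) * (natR (x C i) * Ψ₂ j i)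
    reorder i j = trans (x*yz≈y*xz (natR (x C i)) (natR (y C j)) (Ψ₁ i j))
      (*-congˡ (*-congˡ (sumBox-cong xs (λ α β → inv _ _ _ _ (norm-swap i j α) (norm-swap (x ∸ i) (y ∸ j) β)))))

  sumBox-↭ : ∀ {xs ys} → xs ↭ ys → SumBoxEquivalent xs ys
  sumBox-↭ ↭.refl Ψ inv = refl
  sumBox-↭ {x ∷ xs} {_ ∷ ys} (↭.prep x xs↭ys) = sumBox-∷ x xs ys (sumBox-↭ xs↭ys)
  sumBox-↭ {x ∷ y ∷ xs} {_ ∷ _ ∷ ys} (↭.swap x y xs↭ys) Ψ inv =
    trans (sumBox-swap x y xs Ψ inv) (sumBox-∷ y (x ∷ xs) (x ∷ ys) (sumBox-∷ x xs ys (sumBox-↭ xs↭ys)) Ψ inv)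
  sumBox-↭ (↭.trans xs↭ys ys↭zs) Ψ inv = trans (sumBox-↭ xs↭ys Ψ inv) (sumBox-↭ ys↭zs Ψ inv)

  sumBox-dropZeros : ∀ xs → SumBoxEquivalent xs (dropZeros xs)
  sumBox-dropZeros []           Ψ inv = refl
  sumBox-dropZeros (zero ∷ xs)  Ψ inv = begin
    natR 1 * sumBox xs (λ α β → Ψ (0 ∷ α) (0 ∷ β)) + 0# ≈⟨ +-identityʳ _ ⟩
    natR 1 * sumBox xs (λ α β → Ψ (0 ∷ α) (0 ∷ β))      ≈⟨ natR-1-* _ ⟩
    sumBox xs (λ α β → Ψ (0 ∷ α) (0 ∷ β))               ≈⟨ sumBox-cong xs (λ α β → inv _ _ _ _ ≡.refl ≡.refl) ⟩
    sumBox xs Ψ                                          ≈⟨ sumBox-dropZeros xs Ψ inv ⟩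
    sumBox (dropZeros xs) Ψ                              ∎
  sumBox-dropZeros (suc x ∷ xs) = sumBox-∷ (suc x) xs (dropZeros xs) (sumBox-dropZeros xs)

  sumBox-norm : ∀ xs → SumBoxEquivalent xs (norm xs)
  sumBox-norm xs Ψ inv =
    trans (sumBox-dropZeros xs Ψ inv) (sumBox-↭ (↭.↭-sym (foldr-insertDesc-↭ (dropZeros xs))) Ψ inv)

  -- Sums over colourings

  Weights : Set c
  Weights = ℕ → List ℕ → Carrier

  assign : Weights → ℕ → ℕ → Weights
  assign w v l i M = if v ≡ᵇ i then w i (l ∷ M) else w i M

  -- sumColourings w L k is the sum, over all colourings c of the entries of L by
  -- 0,…,k-1, of ∏_{i<k} w i (c⁻¹ i), where a fibre c⁻¹ i is the sublist of L it forms.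
  sumColourings : Weights → List ℕ → ℕ → Carrier
  sumColourings w []      k = productUpTo k (λ i → w i [])
  sumColourings w (l ∷ L) k = sumUpTo k (λ v → sumColourings (assign w v l) L k)

  assign-cong : ∀ k {w w′ : Weights} v l → (∀ i → i < k → ∀ M → w i M ≈ w′ i M) →
                ∀ i → i < k → ∀ M → assign w v l i M ≈ assign w′ v l i M
  assign-cong k v l w≈w′ i i<k M with v ≡ᵇ i
  ... | true  = w≈w′ i i<k (l ∷ M)
  ... | false = w≈w′ i i<k M

  sumColourings-cong : ∀ L k {w w′ : Weights} → (∀ i → i < k → ∀ M → w i M ≈ w′ i M) →
                       sumColourings w L k ≈ sumColourings w′ L k
  sumColourings-cong []      k w≈w′ = productUpTo-cong k (λ i i<k → w≈w′ i i<k [])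
  sumColourings-cong (l ∷ L) k w≈w′ =
    sumUpTo-cong k (λ v _ → sumColourings-cong L k (assign-cong k v l w≈w′))

  assign-≢ : ∀ (w : Weights) {v i} l M → v ≢ i → assign w v l i M ≡ w i M
  assign-≢ w {v} {i} l M v≢i with v ≡ᵇ i in eq
  ... | true  = ⊥-elim (v≢i (≡ᵇ⇒≡ v i (≡.subst T (≡.sym eq) _)))
  ... | false = ≡.refl

  assign-shift : ∀ k (w : Weights) u l i M →
                 assign w (k ℕ.+ u) l (k ℕ.+ i) M ≡ assign (λ i → w (k ℕ.+ i)) u l i M
  assign-shift zero    w u l i M = ≡.refl
  assign-shift (suc k) w u l i M = assign-shift k (w ∘ suc) u l i M

  sumColourings-assign-below : ∀ L k₁ k₂ (w : Weights) {v} l → v < k₁ →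
    sumColourings (λ i → assign w v l (k₁ ℕ.+ i)) L k₂ ≈ sumColourings (λ i → w (k₁ ℕ.+ i)) L k₂
  sumColourings-assign-below L k₁ k₂ w l v<k₁ = sumColourings-cong L k₂ λ i _ M →
    reflexive (assign-≢ w l M (<⇒≢ (<-≤-trans v<k₁ (m≤m+n k₁ i))))

  sumColourings-assign-above : ∀ L k₁ (w : Weights) u l →
    sumColourings (assign w (k₁ ℕ.+ u) l) L k₁ ≈ sumColourings w L k₁
  sumColourings-assign-above L k₁ w u l = sumColourings-cong L k₁ λ i i<k₁ M →
    reflexive (assign-≢ w l M (λ eq → <⇒≢ (<-≤-trans i<k₁ (m≤m+n k₁ u)) (≡.sym eq)))

  sumColourings-+ : ∀ L k₁ k₂ (w : Weights) →
    sumColourings w L (k₁ ℕ.+ k₂)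
      ≈ sumSplits L (λ A B → sumColourings w A k₁ * sumColourings (λ i → w (k₁ ℕ.+ i)) B k₂)
  sumColourings-+ []      k₁ k₂ w = productUpTo-+ k₁ k₂ (λ i → w i [])
  sumColourings-+ (l ∷ L) k₁ k₂ w = begin
    sumUpTo (k₁ ℕ.+ k₂) (λ v → sumColourings (assign w v l) L (k₁ ℕ.+ k₂))
      ≈⟨ sumUpTo-cong (k₁ ℕ.+ k₂) (λ v _ → sumColourings-+ L k₁ k₂ (assign w v l)) ⟩
    sumUpTo (k₁ ℕ.+ k₂) (λ v → sumSplits L (Φ v))
      ≈⟨ sumUpTo-+ k₁ k₂ (λ v → sumSplits L (Φ v)) ⟩
    sumUpTo k₁ (λ v → sumSplits L (Φ v)) + sumUpTo k₂ (λ u → sumSplits L (Φ (k₁ ℕ.+ u)))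
      ≈⟨ +-cong (sumUpTo-sumSplits L k₁ Φ) (sumUpTo-sumSplits L k₂ (Φ ∘ (k₁ ℕ.+_))) ⟩
    sumSplits L (λ A B → sumUpTo k₁ (λ v → Φ v A B))
      + sumSplits L (λ A B → sumUpTo k₂ (λ u → Φ (k₁ ℕ.+ u) A B))
      ≈⟨ +-cong (sumSplits-cong L first) (sumSplits-cong L second) ⟩
    sumSplits L (λ A B → sumColourings w (l ∷ A) k₁ * sumColourings w′ B k₂)
      + sumSplits L (λ A B → sumColourings w A k₁ * sumColourings w′ (l ∷ B) k₂) ∎
    where
    w′ : Weights
    w′ i = w (k₁ ℕ.+ i)
    Φ : ℕ → List ℕ → List ℕ → Carrier
    Φ v A B = sumColourings (assign w v l) A k₁ * sumColourings (λ i → assign w v l (k₁ ℕ.+ i)) B k₂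
    first : ∀ A B → sumUpTo k₁ (λ v → Φ v A B) ≈ sumColourings w (l ∷ A) k₁ * sumColourings w′ B k₂
    first A B = begin
      sumUpTo k₁ (λ v → Φ v A B)
        ≈⟨ sumUpTo-cong k₁ (λ v v<k₁ →
             *-congˡ {sumColourings (assign w v l) A k₁} (sumColourings-assign-below B k₁ k₂ w l v<k₁)) ⟩
      sumUpTo k₁ (λ v → sumColourings (assign w v l) A k₁ * sumColourings w′ B k₂)
        ≈⟨ *-distribʳ-sumUpTo k₁ (sumColourings w′ B k₂) (λ v → sumColourings (assign w v l) A k₁) ⟨
      sumColourings w (l ∷ A) k₁ * sumColourings w′ B k₂ ∎
    second : ∀ A B → sumUpTo k₂ (λ u → Φ (k₁ ℕ.+ u) A B) ≈ sumColourings w A k₁ * sumColourings w′ (l ∷ B) k₂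
    second A B = begin
      sumUpTo k₂ (λ u → Φ (k₁ ℕ.+ u) A B)
        ≈⟨ sumUpTo-cong k₂ (λ u _ → *-cong (sumColourings-assign-above A k₁ w u l)
             (sumColourings-cong B k₂ (λ i _ M → reflexive (assign-shift k₁ w u l i M)))) ⟩
      sumUpTo k₂ (λ u → sumColourings w A k₁ * sumColourings (assign w′ u l) B k₂)
        ≈⟨ *-distribˡ-sumUpTo k₂ (sumColourings w A k₁) (λ u → sumColourings (assign w′ u l) B k₂) ⟨
      sumColourings w A k₁ * sumColourings w′ (l ∷ B) k₂ ∎

  sumColourings-one : ∀ L (w : Weights) → sumColourings w L 1 ≈ w 0 L
  sumColourings-one []      w = *-identityʳ _
  sumColourings-one (l ∷ L) w = trans (+-identityʳ _) (sumColourings-one L (assign w 0 l))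

  assign-if : ∀ (w : Weights) v l i M → w i (if v ≡ᵇ i then l ∷ M else M) ≡ assign w v l i M
  assign-if w v l i M with v ≡ᵇ i
  ... | true  = ≡.refl
  ... | false = ≡.refl

  sumR-allFuns : ∀ L k (w : Weights) (F : List ℕ → Carrier) →
    (∀ f → length f ≡ length L → F f ≈ productUpTo k (λ i → w i (fiber L f i))) →
    sumR (map F (allFuns (length L) k)) ≈ sumColourings w L k
  sumR-allFuns []      k w F F≈ = trans (+-identityʳ _) (F≈ [] ≡.refl)
  sumR-allFuns (l ∷ L) k w F F≈ = trans (sumR-map-prepend-upTo F k (allFuns (length L) k))
    (sumUpTo-cong k λ v _ → sumR-allFuns L k (assign w v l) (F ∘ (v ∷_)) λ f |f| →
      trans (F≈ (v ∷ f) (≡.cong suc |f|))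
            (productUpTo-cong k λ i _ → reflexive (assign-if w v l i (fiber L f i))))

  -- Generic coefficients

  -- Colour i must receive exactly aᵢ elements; its fibre is a list of block
  -- labels, and counting them per block gives the type of π restricted to it.
  genericWeights : (List ℕ → Carrier) → ℕ → List ℕ → Weights
  genericWeights G m a i M = if length M ≡ᵇ nth a i then G (norm (occurrenceVector m M)) else 0#

  if-eqList-productUpTo : ∀ a (h : ℕ → ℕ) (Q : ℕ → Carrier) →
    (if eqList (applyUpTo h (length a)) a then productUpTo (length a) Q else 0#)
      ≈ productUpTo (length a) (λ i → if h i ≡ᵇ nth a i then Q i else 0#)
  if-eqList-productUpTo []      h Q = refl
  if-eqList-productUpTo (x ∷ a) h Q with h 0 ≡ᵇ x
  ... | true  = trans (if-*ˡ (eqList (applyUpTo (h ∘ suc) (length a)) a))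
                      (*-congˡ (if-eqList-productUpTo a (h ∘ suc) (Q ∘ suc)))
    where
    if-*ˡ : ∀ b {q r} → (if b then q * r else 0#) ≈ q * (if b then r else 0#)
    if-*ˡ true  = refl
    if-*ˡ false = sym (zeroʳ _)
  ... | false = sym (zeroˡ _)

  genericCoeff≈sumColourings : ∀ G xs a →
    genericCoeff G xs a ≈ sumColourings (genericWeights G (length xs) a) (labels xs) (length a)
  genericCoeff≈sumColourings G xs a = begin
    sumR (map F (allFuns (sum xs) k))
      ≡⟨ ≡.cong (λ n → sumR (map F (allFuns n k))) (≡.sym (length-labelsFrom 0 xs)) ⟩
    sumR (map F (allFuns (length (labels xs)) k))
      ≈⟨ sumR-allFuns (labels xs) k W F F≈ ⟩
    sumColourings W (labels xs) k ∎
    where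
    k : ℕ
    k = length a
    W : Weights
    W = genericWeights G (length xs) a
    F : List ℕ → Carrier
    F f = if eqList (fiberSizes k f) a then prodR (map (λ i → G (restrictType xs f i)) (upTo k)) else 0#
    F≈ : ∀ f → length f ≡ length (labels xs) → F f ≈ productUpTo k (λ i → W i (fiber (labels xs) f i))
    F≈ f |f| = begin
      F f
        ≡⟨ ≡.cong₂ (λ u v → if eqList u a then v else 0#) (List.map-applyUpTo id _ k) (prodR-map-upTo k _) ⟩
      (if eqList (applyUpTo (λ i → countTrue (map (_≡ᵇ i) f)) k) a
         then productUpTo k (λ i → G (restrictType xs f i)) else 0#)
        ≈⟨ if-eqList-productUpTo a _ (λ i → G (restrictType xs f i)) ⟩
      productUpTo k (λ i → if countTrue (map (_≡ᵇ i) f) ≡ᵇ nth a i then G (restrictType xs f i) else 0#)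
        ≈⟨ productUpTo-cong k (λ i _ → reflexive (≡.cong₂ (λ u v → if u ≡ᵇ nth a i then G (norm v) else 0#)
             (length-fiber (labels xs) f i |f|)
             (List.map-cong (occurrences-fiber (labels xs) f i) (upTo (length xs))))) ⟩
      productUpTo k (λ i → W i (fiber (labels xs) f i)) ∎

  genericWeights-++ˡ : ∀ G m a b {i} → i < length a → ∀ M →
                       genericWeights G m (a ++ b) i M ≡ genericWeights G m a i M
  genericWeights-++ˡ G m a b i<|a| M =
    ≡.cong (λ t → if length M ≡ᵇ t then G (norm (occurrenceVector m M)) else 0#) (nth-++ˡ a b i<|a|)

  genericWeights-++ʳ : ∀ G m a b i M →
                       genericWeights G m (a ++ b) (length a ℕ.+ i) M ≡ genericWeights G m b i M
  genericWeights-++ʳ G m a b i M =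
    ≡.cong (λ t → if length M ≡ᵇ t then G (norm (occurrenceVector m M)) else 0#) (nth-++ʳ a b i)

  genericCoeff-++-sumBox : ∀ G xs a b →
    genericCoeff G xs (a ++ b) ≈ sumBox xs (λ α β → genericCoeff G α a * genericCoeff G β b)
  genericCoeff-++-sumBox G xs a b = begin
    genericCoeff G xs (a ++ b)
      ≈⟨ genericCoeff≈sumColourings G xs (a ++ b) ⟩
    sumColourings (W (a ++ b)) (labels xs) (length (a ++ b))
      ≡⟨ ≡.cong (sumColourings (W (a ++ b)) (labels xs)) (List.length-++ a) ⟩
    sumColourings (W (a ++ b)) (labels xs) (kᵃ ℕ.+ kᵇ)
      ≈⟨ sumColourings-+ (labels xs) kᵃ kᵇ (W (a ++ b)) ⟩
    sumSplits (labels xs) (λ A B →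
      sumColourings (W (a ++ b)) A kᵃ * sumColourings (λ i → W (a ++ b) (kᵃ ℕ.+ i)) B kᵇ)
      ≈⟨ sumSplits-cong (labels xs) (λ A B → *-cong
           (sumColourings-cong A kᵃ (λ i i<kᵃ → reflexive ∘ genericWeights-++ˡ G m a b i<kᵃ))
           (sumColourings-cong B kᵇ (λ i _ → reflexive ∘ genericWeights-++ʳ G m a b i))) ⟩
    sumSplits (labels xs) (λ A B → sumColourings (W a) A kᵃ * sumColourings (W b) B kᵇ)
      ≈⟨ sumSplits-labelsFrom xs 0 _ ⟩
    sumBox xs (λ α β → sumColourings (W a) (labels α) kᵃ * sumColourings (W b) (labels β) kᵇ)
      ≈⟨ sumBox-cong-length xs (λ α β |α| |β| → sym (*-cong
           (trans (genericCoeff≈sumColourings G α a) (reflexive (≡.cong (λ t → colourings t a α) |α|)))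
           (trans (genericCoeff≈sumColourings G β b) (reflexive (≡.cong (λ t → colourings t b β) |β|))))) ⟩
    sumBox xs (λ α β → genericCoeff G α a * genericCoeff G β b) ∎
    where
    m kᵃ kᵇ : ℕ
    m = length xs
    kᵃ = length a
    kᵇ = length b
    W : List ℕ → Weights
    W = genericWeights G m
    colourings : ℕ → List ℕ → List ℕ → Carrier
    colourings t c α = sumColourings (genericWeights G t c) (labels α) (length c)

  genericCoeff-singleton : ∀ G α x → genericCoeff G α (x ∷ []) ≈ (if sum α ≡ᵇ x then G (norm α) else 0#)
  genericCoeff-singleton G α x = begin
    genericCoeff G α (x ∷ [])
      ≈⟨ genericCoeff≈sumColourings G α (x ∷ []) ⟩
    sumColourings (genericWeights G (length α) (x ∷ [])) (labels α) 1
      ≈⟨ sumColourings-one (labels α) _ ⟩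
    (if length (labels α) ≡ᵇ x then G (norm (occurrenceVector (length α) (labels α))) else 0#)
      ≡⟨ ≡.cong₂ (λ n v → if n ≡ᵇ x then G (norm v) else 0#) (length-labelsFrom 0 α) (occurrenceVector-labels α) ⟩
    (if sum α ≡ᵇ x then G (norm α) else 0#) ∎

  -- Peeling off the first variable writes the coefficient as a box sum whose
  -- summand depends on α only through sum α and norm α, so sumBox-norm applies.
  genericCoeff-norm : ∀ G a xs → genericCoeff G xs a ≈ genericCoeff G (norm xs) a
  genericCoeff-norm G []      xs =
    reflexive (≡.cong (λ n → sumR (map (λ _ → 1#) (allFuns n 0))) (≡.sym (sum-norm xs)))
  genericCoeff-norm G (x ∷ a) xs = begin
    genericCoeff G xs ((x ∷ []) ++ a)        ≈⟨ genericCoeff-++-sumBox G xs (x ∷ []) a ⟩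
    sumBox xs Ψ                              ≈⟨ sumBox-norm xs Ψ Ψ-inv ⟩
    sumBox (norm xs) Ψ                       ≈⟨ genericCoeff-++-sumBox G (norm xs) (x ∷ []) a ⟨
    genericCoeff G (norm xs) ((x ∷ []) ++ a) ∎
    where
    Ψ : List ℕ → List ℕ → Carrier
    Ψ α β = genericCoeff G α (x ∷ []) * genericCoeff G β a
    Ψ-inv : NormInvariant Ψ
    Ψ-inv α α′ β β′ α∼α′ β∼β′ = *-cong
      (begin
        genericCoeff G α (x ∷ [])                 ≈⟨ genericCoeff-singleton G α x ⟩
        (if sum α ≡ᵇ x then G (norm α) else 0#)   ≡⟨ ≡.cong₂ (λ s ν → if s ≡ᵇ x then G ν else 0#) sum-α≡sum-α′ α∼α′ ⟩
        (if sum α′ ≡ᵇ x then G (norm α′) else 0#) ≈⟨ genericCoeff-singleton G α′ x ⟨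
        genericCoeff G α′ (x ∷ [])                ∎)
      (begin
        genericCoeff G β a         ≈⟨ genericCoeff-norm G a β ⟩
        genericCoeff G (norm β) a  ≡⟨ ≡.cong (λ ν → genericCoeff G ν a) β∼β′ ⟩
        genericCoeff G (norm β′) a ≈⟨ genericCoeff-norm G a β′ ⟨
        genericCoeff G β′ a        ∎)
      where
      sum-α≡sum-α′ : sum α ≡ sum α′
      sum-α≡sum-α′ = ≡.trans (≡.sym (sum-norm α)) (≡.trans (≡.cong sum α∼α′) (sum-norm α′))

  genericCoeff-++ : ∀ G xs a b →
    genericCoeff G xs (a ++ b) ≈ sumBox xs (λ α β → genericCoeff G (norm α) a * genericCoeff G (norm β) b)
  genericCoeff-++ G xs a b = trans (genericCoeff-++-sumBox G xs a b)
    (sumBox-cong xs (λ α β → *-cong (genericCoeff-norm G a α) (genericCoeff-norm G b β)))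

  generic⇒binomialType : ∀ G p → EnumeratesGeneric G p → BinomialType p
  generic⇒binomialType G p enumerates λ' isP a b = begin
    p λ' (norm (a ++ b))
      ≈⟨ enumerates λ' isP (a ++ b) ⟩
    genericCoeff G λ' (a ++ b)
      ≈⟨ genericCoeff-++ G λ' a b ⟩
    sumBox λ' (λ α β → genericCoeff G (norm α) a * genericCoeff G (norm β) b)
      ≈⟨ sumBox-cong λ' (λ α β → sym (*-cong (enumerates (norm α) (IsPartition-norm α) a)
                                             (enumerates (norm β) (IsPartition-norm β) b))) ⟩
    sumBox λ' (λ α β → p (norm α) (norm a) * p (norm β) (norm b))
      ≈⟨ sumR-boxes λ' (λ α β → p (norm α) (norm a) * p (norm β) (norm b)) ⟨
    sumR (map (λ α → natR (binomL λ' α) * (p (norm α) (norm a) * p (norm (λ' -ᴸ α)) (norm b))) (boxes λ')) ∎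

  nonzero-idempotent≈1 : IsField → ∀ {x} → x ≈ x * x → ¬ x ≈ 0# → x ≈ 1#
  nonzero-idempotent≈1 (_ , inverse) {x} x≈x² x≉0 with inverse x x≉0
  ... | y , xy≈1 = begin
    x           ≈⟨ *-identityʳ x ⟨
    x * 1#      ≈⟨ *-congˡ xy≈1 ⟨
    x * (x * y) ≈⟨ *-assoc x x y ⟨
    x * x * y   ≈⟨ *-congʳ x≈x² ⟨
    x * y       ≈⟨ xy≈1 ⟩
    1#          ∎

  singleVariableCoeff : (List ℕ → SymFun) → List ℕ → Carrier
  singleVariableCoeff p μ = p μ (norm (sum μ ∷ []))

  -- The binomial identity at λ = a = b = [] reads p_∅ = p_∅ · p_∅.
  binomialType⇒p[]≈1 : IsField → ∀ p → FullSequence p → BinomialType p → p [] [] ≈ 1#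
  binomialType⇒p[]≈1 isField p full binomial = nonzero-idempotent≈1 isField
    (trans (binomial [] tt [] []) (trans (+-identityʳ _) (natR-1-* _)))
    (proj₁ (proj₂ (full [] tt)))

  fullSequence-singleton : ∀ p → FullSequence p → ∀ μ → IsPartition μ → ∀ x →
    p μ (norm (x ∷ [])) ≈ (if sum μ ≡ᵇ x then singleVariableCoeff p μ else 0#)
  fullSequence-singleton p full μ isP x with sum μ ≡ᵇ x in eq
  ... | true  = reflexive (≡.cong (λ t → p μ (norm (t ∷ []))) (≡.sym (≡ᵇ⇒≡ (sum μ) x (≡.subst T (≡.sym eq) _))))
  ... | false = proj₁ (full μ isP) (norm (x ∷ [])) (IsPartition-norm (x ∷ [])) λ sum≡ →
    ≡.subst T eq (≡⇒≡ᵇ _ _ (≡.trans (≡.sym sum≡) (≡.trans (sum-norm (x ∷ [])) (ℕ.+-identityʳ x))))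

  fullSequence≈genericCoeff-singleton : ∀ p → FullSequence p → ∀ α x →
    p (norm α) (norm (x ∷ [])) ≈ genericCoeff (singleVariableCoeff p) (norm α) (x ∷ [])
  fullSequence≈genericCoeff-singleton p full α x = begin
    p (norm α) (norm (x ∷ []))
      ≈⟨ fullSequence-singleton p full (norm α) (IsPartition-norm α) x ⟩
    (if sum (norm α) ≡ᵇ x then G (norm α) else 0#)
      ≡⟨ ≡.cong (λ ν → if sum (norm α) ≡ᵇ x then G ν else 0#) (norm-idem α) ⟨
    (if sum (norm α) ≡ᵇ x then G (norm (norm α)) else 0#)
      ≈⟨ genericCoeff-singleton G (norm α) x ⟨
    genericCoeff G (norm α) (x ∷ []) ∎
    where
    G : List ℕ → Carrier
    G = singleVariableCoeff p

  binomialType⇒generic : IsField → ∀ p → FullSequence p → BinomialType p →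
                         ∃ λ G → QuasiGenus G × EnumeratesGeneric G p
  binomialType⇒generic isField p full binomial =
    G , (binomialType⇒p[]≈1 isField p full binomial , proj₁ (proj₂ (full (1 ∷ []) (s≤s z≤n)))) , enumerates
    where
    G : List ℕ → Carrier
    G = singleVariableCoeff p
    enumerates : EnumeratesGeneric G p
    enumerates []           _   []      = trans (binomialType⇒p[]≈1 isField p full binomial) (sym (+-identityʳ 1#))
    enumerates (zero ∷ xs)  isP []      with () ← IsPartition-head>0 0 xs isP
    enumerates (suc x ∷ xs) isP []      = proj₁ (full (suc x ∷ xs) isP) [] tt (λ ())
    enumerates λ'           isP (x ∷ a) = begin
      p λ' (norm ((x ∷ []) ++ a))
        ≈⟨ binomial λ' isP (x ∷ []) a ⟩
      sumR (map (λ α → natR (binomL λ' α) * (p (norm α) (norm (x ∷ [])) * p (norm (λ' -ᴸ α)) (norm a))) (boxes λ'))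
        ≈⟨ sumR-boxes λ' (λ α β → p (norm α) (norm (x ∷ [])) * p (norm β) (norm a)) ⟩
      sumBox λ' (λ α β → p (norm α) (norm (x ∷ [])) * p (norm β) (norm a))
        ≈⟨ sumBox-cong λ' (λ α β → *-cong (fullSequence≈genericCoeff-singleton p full α x)
                                          (enumerates (norm β) (IsPartition-norm β) a)) ⟩
      sumBox λ' (λ α β → genericCoeff G (norm α) (x ∷ []) * genericCoeff G (norm β) a)
        ≈⟨ genericCoeff-++ G λ' (x ∷ []) a ⟨
      genericCoeff G λ' ((x ∷ []) ++ a) ∎

theorem12 : ∀ {c ℓ : Level} (R : CommutativeRing c ℓ) → WithRing.IsField R →
    (p : List ℕ → List ℕ → CommutativeRing.Carrier R) → WithRing.FullSequence R p →
    (WithRing.BinomialType R p →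
       ∃ λ (G : List ℕ → CommutativeRing.Carrier R) →
         WithRing.QuasiGenus R G × WithRing.EnumeratesGeneric R G p)
    × ((∃ λ (G : List ℕ → CommutativeRing.Carrier R) →
         WithRing.QuasiGenus R G × WithRing.EnumeratesGeneric R G p)
       → WithRing.BinomialType R p)
theorem12 R isField p full =
  binomialType⇒generic isField p full ,
  λ (G , _ , enumerates) → generic⇒binomialType G p enumerates
  where open GenericCoefficients R
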